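{- For all $n$ we have $B_n(123,213) = \mathrm{CRY}_n$.
   Context: Matrices $M=(m_{x,y})$ are indexed in Cartesian coordinates: $m_{x,y}$ is the entry in the $x$th column from the left and the $y$th row from the bottom; the matrix of $\sigma\in\mathfrak{S}_n$ has $m_{x,y}=1$ iff $y=\sigma(x)$, and $0$ otherwise. $B_n(123,213)$ is the convex hull of the matrices of the permutations in $\mathfrak{S}_n$ avoiding both patterns $123$ and $213$. The Chan-Robbins-Yuen polytope is $\mathrm{CRY}_n=\operatorname{conv}\{(m_{x,y}) : (m_{x,y})$ a permutation matrix with $m_{x,y}=0$ for all $x\ge n+3-y\}$.
   Formalization: The polytopes $B_n(123,213)$ and $\mathrm{CRY}_n$ contain only matrices with rational entries, each a convex combination of its vertices with rational coefficients. -}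

module Defs where

open import Data.Nat as ℕ using (ℕ; suc; _+_; _∸_)
open import Data.Fin using (Fin; toℕ)
open import Data.Fin.Permutation using (Permutation′; _⟨$⟩ʳ_)
open import Data.Rational as ℚ using (ℚ; 0ℚ; 1ℚ)
open import Data.List using (List; map; foldr)
open import Data.List.Relation.Unary.All using (All)
open import Data.Product using (_×_; proj₁; proj₂; ∃; ∃-syntax; Σ)
open import Relation.Binary.PropositionalEquality using (_≡_)
open import Relation.Nullary using (¬_)
open import Relation.Nullary.Decidable using (⌊_⌋)
open import Data.Fin using (_≟_)
open import Data.Bool using (if_then_else_)

-- n×n rational matrices, indexed Cartesian-style: M x y = entry in column x
-- (from the left) and row y (from the bottom), 0-indexed.
Matrix : ℕ → Set
Matrix n = Fin n → Fin n → ℚ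

permMatrix : ∀ {n} → Permutation′ n → Matrix n
permMatrix σ x y = if ⌊ y ≟ σ ⟨$⟩ʳ x ⌋ then 1ℚ else 0ℚ

IsMatrixOf : ∀ {n} → Matrix n → Permutation′ n → Set
IsMatrixOf M σ = ∀ x y → M x y ≡ permMatrix σ x y

Contains123 : ∀ {n} → Permutation′ n → Set
Contains123 {n} σ = ∃[ i ] ∃[ j ] ∃[ k ]
  (toℕ i ℕ.< toℕ j × toℕ j ℕ.< toℕ k ×
   toℕ (σ ⟨$⟩ʳ i) ℕ.< toℕ (σ ⟨$⟩ʳ j) × toℕ (σ ⟨$⟩ʳ j) ℕ.< toℕ (σ ⟨$⟩ʳ k))

Contains213 : ∀ {n} → Permutation′ n → Set
Contains213 {n} σ = ∃[ i ] ∃[ j ] ∃[ k ]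
  (toℕ i ℕ.< toℕ j × toℕ j ℕ.< toℕ k ×
   toℕ (σ ⟨$⟩ʳ j) ℕ.< toℕ (σ ⟨$⟩ʳ i) × toℕ (σ ⟨$⟩ʳ i) ℕ.< toℕ (σ ⟨$⟩ʳ k))

Avoids123-213 : ∀ {n} → Permutation′ n → Set
Avoids123-213 σ = ¬ Contains123 σ × ¬ Contains213 σ

sumℚ : List ℚ → ℚ
sumℚ = foldr ℚ._+_ 0ℚ

combo : ∀ {n} → List (ℚ × Matrix n) → Matrix n
combo ps x y = sumℚ (map (λ p → proj₁ p ℚ.* proj₂ p x y) ps)

InConv : ∀ {n} → (Matrix n → Set) → Matrix n → Set
InConv {n} S M = Σ (List (ℚ × Matrix n)) λ ps →
  All (λ p → 0ℚ ℚ.≤ proj₁ p × S (proj₂ p)) ps ×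
  sumℚ (map proj₁ ps) ≡ 1ℚ ×
  (∀ x y → M x y ≡ combo ps x y)

B-vertex : ∀ {n} → Matrix n → Set
B-vertex M = ∃[ σ ] (Avoids123-213 σ × IsMatrixOf M σ)

-- CRY vertices: permutation matrices with m_{x,y} = 0 whenever x ≥ n+3−y,
-- written with 1-indexed coordinates x = toℕ x + 1, y = toℕ y + 1.
CRY-vertex : ∀ {n} → Matrix n → Set
CRY-vertex {n} M = ∃[ σ ] (IsMatrixOf M σ ×
  (∀ x y → n + 3 ∸ (toℕ y + 1) ℕ.≤ toℕ x + 1 → M x y ≡ 0ℚ))

B123-213 : (n : ℕ) → Matrix n → Set
B123-213 n = InConv (B-vertex {n})

CRY : (n : ℕ) → Matrix n → Set
CRY n = InConv (CRY-vertex {n})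

-- A permutation avoids 123 and 213 exactly when no entry has two smaller
-- entries to its left, and this happens exactly when its graph lies weakly
-- below the antidiagonal, x + σ(x) ≤ n (0-indexed), which is the zero pattern
-- of CRY_n. Both directions of the second equivalence are pigeonhole counts:
-- if x + σ(x) > n, the x positions left of x are too many for all but one of
-- them to carry one of the n − 1 − σ(x) values above σ(x); conversely, if
-- x + σ(x) ≤ n everywhere, the n − v values ≥ v sit in the first n − v + 1
-- positions, leaving room for only one smaller value there.
-- So the two polytopes have the same vertices.
module Submission where

open import Defs
open import Data.Nat using (ℕ)
open import Data.Product using (_×_)

open import Data.Nat
  using (zero; suc; _+_; _∸_; _≤_; _<_; _≤?_; _<?_; z≤n; s≤s)
open import Data.Nat.Properties
  using ( <-cmp; <-irrefl; <-trans; <⇒≤; <⇒≱; ≰⇒>; ≤-refl; ≤-trans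
        ; n<1+n; m<n⇒m<1+n; m≤m+n; m∸n≤m; +-comm; +-cancelˡ-≡; +-monoʳ-<
        ; ∸-monoˡ-<; ∸-monoʳ-≤; m∸n+n≡m; m+[n∸m]≡n
        ; m+n≤o⇒m≤o∸n; m≤o∸n⇒m+n≤o)
open import Data.Fin using (Fin; toℕ; fromℕ<; inject; _≟_)
open import Data.Fin.Properties
  using (toℕ-injective; toℕ<n; toℕ-fromℕ<; toℕ-inject; injective⇒≤; any?)
open import Data.Fin.Permutation
  using (Permutation′; _⟨$⟩ʳ_; _⟨$⟩ˡ_; inverseˡ; inverseʳ)
open import Data.Vec.Functional using (Vector; _∷_)
open import Data.Product using (_,_; ∃-syntax)
open import Data.Empty using (⊥-elim)
open import Data.List.Relation.Unary.All as All using ()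
open import Data.Rational using (0ℚ; 1ℚ)
open import Function.Bundles using (_⇔_; mk⇔; Equivalence)
open import Function.Definitions using (Injective)
open import Relation.Binary.Definitions using (tri<; tri≈; tri>)
open import Relation.Binary.PropositionalEquality
  using (_≡_; _≢_; refl; sym; trans; cong; subst; module ≡-Reasoning)
open import Relation.Nullary using (¬_; Dec; yes; no)
open import Relation.Nullary.Decidable using (decidable-stable; _×-dec_)

module _ {a} {A : Set a} {m : ℕ} {x : A} {f : Vector A m} where

  ∷-injective : (∀ t → f t ≢ x) → Injective _≡_ _≡_ f → Injective _≡_ _≡_ (x ∷ f)
  ∷-injective _   _     {Fin.zero}  {Fin.zero}  _   = refl
  ∷-injective x∉f _     {Fin.zero}  {Fin.suc t} eq  = ⊥-elim (x∉f t (sym eq))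
  ∷-injective x∉f _     {Fin.suc t} {Fin.zero}  eq  = ⊥-elim (x∉f t eq)
  ∷-injective _   f-inj {Fin.suc s} {Fin.suc t} eq  = cong Fin.suc (f-inj eq)

injective⇒≤-interval : ∀ {m lo hi} (f : Fin m → ℕ) → Injective _≡_ _≡_ f →
                       (∀ i → lo ≤ f i) → (∀ i → f i < hi) → m ≤ hi ∸ lo
injective⇒≤-interval {m} {lo} {hi} f f-inj lo≤f f<hi = injective⇒≤ g-inj
  where
  g : Fin m → Fin (hi ∸ lo)
  g i = fromℕ< (∸-monoˡ-< (f<hi i) (lo≤f i))

  g-inj : Injective _≡_ _≡_ g
  g-inj {i} {j} gi≡gj = f-inj (begin
    f i            ≡⟨ sym (m∸n+n≡m (lo≤f i)) ⟩
    f i ∸ lo + lo  ≡⟨ cong (_+ lo) (trans (sym (toℕ-fromℕ< _)) (trans (cong toℕ gi≡gj) (toℕ-fromℕ< _))) ⟩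
    f j ∸ lo + lo  ≡⟨ m∸n+n≡m (lo≤f j) ⟩
    f j            ∎)
    where open ≡-Reasoning

value : ∀ {n} → Permutation′ n → Fin n → ℕ
value σ x = toℕ (σ ⟨$⟩ʳ x)

BelowAntidiagonal : ∀ {n} → Permutation′ n → Set
BelowAntidiagonal {n} σ = ∀ x → toℕ x + value σ x ≤ n

HasTwoSmallerPredecessors : ∀ {n} → Permutation′ n → Set
HasTwoSmallerPredecessors σ = ∃[ i ] ∃[ j ] ∃[ k ]
  (toℕ i < toℕ j × toℕ j < toℕ k × value σ i < value σ k × value σ j < value σ k)

module _ {n : ℕ} (σ : Permutation′ n) where

  value-injective : ∀ {p q} → value σ p ≡ value σ q → p ≡ q
  value-injective {p} {q} vp≡vq =
    trans (sym (inverseˡ σ)) (trans (cong (σ ⟨$⟩ˡ_) (toℕ-injective vp≡vq)) (inverseˡ σ))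

  ¬smaller⇒larger : ∀ {p x} → toℕ p < toℕ x → ¬ (value σ p < value σ x) → value σ x < value σ p
  ¬smaller⇒larger {p} {x} p<x vp≮vx with <-cmp (value σ p) (value σ x)
  ... | tri< vp<vx _ _ = ⊥-elim (vp≮vx vp<vx)
  ... | tri≈ _ vp≡vx _ = ⊥-elim (<-irrefl (cong toℕ (value-injective vp≡vx)) p<x)
  ... | tri> _ _ vx<vp = vx<vp

  twoSmallerPredecessors : ∀ {i j k} → i ≢ j → toℕ i < toℕ k → toℕ j < toℕ k →
                           value σ i < value σ k → value σ j < value σ k →
                           HasTwoSmallerPredecessors σ
  twoSmallerPredecessors {i} {j} {k} i≢j i<k j<k vi<vk vj<vk with <-cmp (toℕ i) (toℕ j)
  ... | tri< i<j _ _ = i , j , k , i<j , j<k , vi<vk , vj<vk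
  ... | tri≈ _ i≡j _ = ⊥-elim (i≢j (toℕ-injective i≡j))
  ... | tri> _ _ j<i = j , i , k , j<i , i<k , vj<vk , vi<vk

  avoids⇒¬twoSmallerPredecessors : Avoids123-213 σ → ¬ HasTwoSmallerPredecessors σ
  avoids⇒¬twoSmallerPredecessors (no123 , no213) (i , j , k , i<j , j<k , vi<vk , vj<vk)
    with <-cmp (value σ i) (value σ j)
  ... | tri< vi<vj _ _ = no123 (i , j , k , i<j , j<k , vi<vj , vj<vk)
  ... | tri≈ _ vi≡vj _ = <-irrefl (cong toℕ (value-injective vi≡vj)) i<j
  ... | tri> _ _ vj<vi = no213 (i , j , k , i<j , j<k , vj<vi , vi<vk)

  ¬twoSmallerPredecessors⇒avoids : ¬ HasTwoSmallerPredecessors σ → Avoids123-213 σ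
  ¬twoSmallerPredecessors⇒avoids none =
      (λ (i , j , k , i<j , j<k , vi<vj , vj<vk) →
         none (i , j , k , i<j , j<k , <-trans vi<vj vj<vk , vj<vk))
    , (λ (i , j , k , i<j , j<k , vj<vi , vi<vk) →
         none (i , j , k , i<j , j<k , vi<vk , <-trans vj<vi vi<vk))

  belowAntidiagonal⇒¬twoSmallerPredecessors : BelowAntidiagonal σ → ¬ HasTwoSmallerPredecessors σ
  belowAntidiagonal⇒¬twoSmallerPredecessors below (i , j , k , i<j , j<k , vi<v , vj<v) =
    <-irrefl refl (injective⇒≤-interval positions positions-injective (λ _ → z≤n) positions<)
    where
    v : ℕ
    v = value σ k

    m : ℕ
    m = n ∸ v

    position≤ : ∀ p → v ≤ value σ p → toℕ p ≤ m
    position≤ p v≤vp = ≤-trans (m+n≤o⇒m≤o∸n (toℕ p) (below p)) (∸-monoʳ-≤ n v≤vp)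

    high : Fin m → Fin n
    high t = fromℕ< (subst (v + toℕ t <_) (m+[n∸m]≡n (<⇒≤ (toℕ<n (σ ⟨$⟩ʳ k))))
                           (+-monoʳ-< v (toℕ<n t)))

    value-high : ∀ t → value σ (σ ⟨$⟩ˡ high t) ≡ v + toℕ t
    value-high t = trans (cong toℕ (inverseʳ σ)) (toℕ-fromℕ< _)

    v≤value-high : ∀ t → v ≤ value σ (σ ⟨$⟩ˡ high t)
    v≤value-high t = subst (v ≤_) (sym (value-high t)) (m≤m+n v (toℕ t))

    highPositions : Vector ℕ m
    highPositions t = toℕ (σ ⟨$⟩ˡ high t)

    highPositions-injective : Injective _≡_ _≡_ highPositions
    highPositions-injective {s} {t} eq = toℕ-injective (+-cancelˡ-≡ v (toℕ s) (toℕ t)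
      (trans (sym (value-high s)) (trans (cong (value σ) (toℕ-injective eq)) (value-high t))))

    highPositions-avoid : ∀ p → value σ p < v → ∀ t → highPositions t ≢ toℕ p
    highPositions-avoid p vp<v t eq =
      <⇒≱ vp<v (subst (v ≤_) (cong (value σ) (toℕ-injective eq)) (v≤value-high t))

    positions : Vector ℕ (2 + m)
    positions = toℕ i ∷ toℕ j ∷ highPositions

    positions-injective : Injective _≡_ _≡_ positions
    positions-injective = ∷-injective
      (λ { Fin.zero i≡j → <-irrefl (sym i≡j) i<j
         ; (Fin.suc t) → highPositions-avoid i vi<v t })
      (∷-injective (highPositions-avoid j vj<v) highPositions-injective)

    k≤m : toℕ k ≤ m
    k≤m = position≤ k ≤-refl

    positions< : ∀ a → positions a < suc m
    positions< Fin.zero              = s≤s (≤-trans (<⇒≤ (<-trans i<j j<k)) k≤m)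
    positions< (Fin.suc Fin.zero)    = s≤s (≤-trans (<⇒≤ j<k) k≤m)
    positions< (Fin.suc (Fin.suc t)) = s≤s (position≤ _ (v≤value-high t))

  atMostOneSmallerPredecessor⇒bound : ∀ x e → (∀ p → toℕ p < toℕ x → p ≢ e → value σ x < value σ p) →
                                      toℕ x + value σ x ≤ n
  atMostOneSmallerPredecessor⇒bound x e larger =
    m≤o∸n⇒m+n≤o (toℕ x) (<⇒≤ (toℕ<n (σ ⟨$⟩ʳ x))) (injective⇒≤-interval f f-injective f-lo f-hi)
    where
    -- The exception e is sent to n, above every value, so that the map stays injective.
    valueOrTop : (q : Fin n) → Dec (q ≡ e) → ℕ
    valueOrTop _ (yes _) = n
    valueOrTop q (no _)  = value σ q

    valueOrTop-injective : ∀ q r dq dr → valueOrTop q dq ≡ valueOrTop r dr → q ≡ r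
    valueOrTop-injective q r (yes q≡e) (yes r≡e) _  = trans q≡e (sym r≡e)
    valueOrTop-injective q r (yes _)   (no _)    eq = ⊥-elim (<-irrefl (sym eq) (toℕ<n (σ ⟨$⟩ʳ r)))
    valueOrTop-injective q r (no _)    (yes _)   eq = ⊥-elim (<-irrefl eq (toℕ<n (σ ⟨$⟩ʳ q)))
    valueOrTop-injective q r (no _)    (no _)    eq = value-injective eq

    f : Fin (toℕ x) → ℕ
    f p = valueOrTop (inject p) (inject p ≟ e)

    f-injective : Injective _≡_ _≡_ f
    f-injective {p} {q} eq = toℕ-injective (trans (sym (toℕ-inject p))
      (trans (cong toℕ (valueOrTop-injective _ _ (inject p ≟ e) (inject q ≟ e) eq)) (toℕ-inject q)))

    f-lo : ∀ p → suc (value σ x) ≤ f p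
    f-lo p with inject p ≟ e
    ... | yes _  = toℕ<n (σ ⟨$⟩ʳ x)
    ... | no p≢e = larger (inject p) (subst (_< toℕ x) (sym (toℕ-inject p)) (toℕ<n p)) p≢e

    f-hi : ∀ p → f p < suc n
    f-hi p with inject p ≟ e
    ... | yes _ = n<1+n n
    ... | no _  = m<n⇒m<1+n (toℕ<n (σ ⟨$⟩ʳ inject p))

  ¬twoSmallerPredecessors⇒belowAntidiagonal : ¬ HasTwoSmallerPredecessors σ → BelowAntidiagonal σ
  ¬twoSmallerPredecessors⇒belowAntidiagonal none x
    with any? (λ p → (toℕ p <? toℕ x) ×-dec (value σ p <? value σ x))
  ... | yes (i , i<x , vi<vx) = atMostOneSmallerPredecessor⇒bound x i λ p p<x p≢i →
          ¬smaller⇒larger p<x λ vp<vx → none (twoSmallerPredecessors p≢i p<x i<x vp<vx vi<vx)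
  ... | no noneSmaller = atMostOneSmallerPredecessor⇒bound x x λ p p<x _ →
          ¬smaller⇒larger p<x λ vp<vx → noneSmaller (p , p<x , vp<vx)

  avoids⇔belowAntidiagonal : Avoids123-213 σ ⇔ BelowAntidiagonal σ
  avoids⇔belowAntidiagonal = mk⇔
    (λ avoids → ¬twoSmallerPredecessors⇒belowAntidiagonal (avoids⇒¬twoSmallerPredecessors avoids))
    (λ below → ¬twoSmallerPredecessors⇒avoids (belowAntidiagonal⇒¬twoSmallerPredecessors below))

staircase⇔aboveAntidiagonal : ∀ n x y → (n + 3 ∸ (y + 1) ≤ x + 1) ⇔ (n < x + y)
staircase⇔aboveAntidiagonal n x y
  rewrite +-comm n 3 | +-comm y 1 | +-comm x 1 | +-comm x y = mk⇔ (to n y x) (from n y x)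
  where
  to : ∀ n y x → 2 + n ∸ y ≤ 1 + x → n < y + x
  to n       zero    x (s≤s h) = h
  to zero    (suc y) x _       = s≤s z≤n
  to (suc n) (suc y) x h       = s≤s (to n y x h)

  from : ∀ n y x → n < y + x → 2 + n ∸ y ≤ 1 + x
  from n       zero    x n<x         = s≤s n<x
  from zero    (suc y) x _           = ≤-trans (m∸n≤m 1 y) (s≤s z≤n)
  from (suc n) (suc y) x (s≤s n<y+x) = from n y x n<y+x

permMatrix-off : ∀ {n} (σ : Permutation′ n) {x y} → y ≢ σ ⟨$⟩ʳ x → permMatrix σ x y ≡ 0ℚ
permMatrix-off σ {x} {y} y≢σx with y ≟ σ ⟨$⟩ʳ x
... | yes y≡σx = ⊥-elim (y≢σx y≡σx)
... | no _     = refl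

permMatrix-graph : ∀ {n} (σ : Permutation′ n) x → permMatrix σ x (σ ⟨$⟩ʳ x) ≡ 1ℚ
permMatrix-graph σ x with σ ⟨$⟩ʳ x ≟ σ ⟨$⟩ʳ x
... | yes _   = refl
... | no σx≢σx = ⊥-elim (σx≢σx refl)

StaircaseZeros : ∀ {n} → Matrix n → Set
StaircaseZeros {n} M = ∀ x y → n + 3 ∸ (toℕ y + 1) ≤ toℕ x + 1 → M x y ≡ 0ℚ

module _ {n : ℕ} {M : Matrix n} {σ : Permutation′ n} (M≡σ : IsMatrixOf M σ) where

  staircaseZeros⇔belowAntidiagonal : StaircaseZeros M ⇔ BelowAntidiagonal σ
  staircaseZeros⇔belowAntidiagonal = mk⇔ zeros⇒below below⇒zeros
    where
    zeros⇒below : StaircaseZeros M → BelowAntidiagonal σ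
    zeros⇒below zeros x = decidable-stable (_ ≤? n) λ above →
      1ℚ≢0ℚ (begin
        1ℚ                         ≡⟨ sym (permMatrix-graph σ x) ⟩
        permMatrix σ x (σ ⟨$⟩ʳ x)  ≡⟨ sym (M≡σ x _) ⟩
        M x (σ ⟨$⟩ʳ x)             ≡⟨ zeros x _ (Equivalence.from (staircase⇔aboveAntidiagonal n _ _) (≰⇒> above)) ⟩
        0ℚ                         ∎)
      where
      open ≡-Reasoning
      1ℚ≢0ℚ : 1ℚ ≢ 0ℚ
      1ℚ≢0ℚ ()

    below⇒zeros : BelowAntidiagonal σ → StaircaseZeros M
    below⇒zeros below x y outside = trans (M≡σ x y) (permMatrix-off σ λ y≡σx →
      <⇒≱ (Equivalence.to (staircase⇔aboveAntidiagonal n _ _) outside)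
          (subst (λ z → toℕ x + toℕ z ≤ n) (sym y≡σx) (below x)))

B-vertex⇔CRY-vertex : ∀ {n} (M : Matrix n) → B-vertex M ⇔ CRY-vertex M
B-vertex⇔CRY-vertex M = mk⇔
  (λ (σ , avoids , M≡σ) → σ , M≡σ ,
     Equivalence.from (staircaseZeros⇔belowAntidiagonal {M = M} {σ} M≡σ)
                      (Equivalence.to (avoids⇔belowAntidiagonal σ) avoids))
  (λ (σ , M≡σ , zeros) → σ ,
     Equivalence.from (avoids⇔belowAntidiagonal σ)
                      (Equivalence.to (staircaseZeros⇔belowAntidiagonal {M = M} {σ} M≡σ) zeros) , M≡σ)

InConv-mono : ∀ {n} {S T : Matrix n → Set} → (∀ {M} → S M → T M) → ∀ {M} → InConv S M → InConv T M
InConv-mono S⊆T (ps , vertices , weights , M≡combo) =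
  ps , All.map (λ (λ≥0 , p∈S) → λ≥0 , S⊆T p∈S) vertices , weights , M≡combo

proposition4p4 : (n : ℕ) (M : Matrix n) → (B123-213 n M → CRY n M) × (CRY n M → B123-213 n M)
proposition4p4 n M =
    InConv-mono (Equivalence.to (B-vertex⇔CRY-vertex _))
  , InConv-mono (Equivalence.from (B-vertex⇔CRY-vertex _))
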